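{- Let $X$ be a finite set, $R\subseteq X\times X$, and $\mathcal{M}=((X,\mathcal{C}_R),\mathcal{V})$ a finite quasi-discrete closure model. For every SLCS formula $\phi$ and every $x\in X$: $x\in\mathrm{check}(\mathcal{M},\phi)$ if and only if $\mathcal{M},x\models\phi$.
   Context: $\mathcal{C}_R(A)=A\cup\{x\in X\mid\exists a\in A.(a,x)\in R\}$; for $A\subseteq X$, $\mathcal{B}^+(A)=\mathcal{C}_R(A)\setminus A$. Fix a set $P$ of proposition letters and $\mathcal{V}:P\to2^X$. SLCS formulas: $\Phi::=p\mid\top\mid\neg\Phi\mid\Phi\wedge\Phi\mid\lozenge\Phi\mid\Phi\,\mathcal{U}\,\Phi$. Satisfaction: $\mathcal{M},x\models p$ iff $x\in\mathcal{V}(p)$; $\top$ always; $\neg,\wedge$ as usual; $\mathcal{M},x\models\lozenge\phi$ iff $x\in\mathcal{C}_R(\{y\mid\mathcal{M},y\models\phi\})$; $\mathcal{M},x\models\phi\,\mathcal{U}\,\psi$ iff there is $A\subseteq X$ with $x\in A$, $\mathcal{M},y\models\phi$ for all $y\in A$, and $\mathcal{M},z\models\psi$ for all $z\in\mathcal{B}^+(A)$. The procedure $\mathrm{check}(\mathcal{M},\phi)$ is defined recursively: for $\top$ return $X$; for $p$ return $\mathcal{V}(p)$; for $\neg\psi$ return $X\setminus\mathrm{check}(\mathcal{M},\psi)$; for $\psi\wedge\xi$ return the intersection of the results for $\psi$ and $\xi$; for $\lozenge\psi$ return $\mathcal{C}_R(\mathrm{check}(\mathcal{M},\psi))$; for $\psi\,\mathcal{U}\,\xi$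 run: $V:=\mathrm{check}(\mathcal{M},\psi)$; $Q:=\mathrm{check}(\mathcal{M},\xi)$; $T:=\mathcal{B}^+(V\cup Q)$; while $T\neq\emptyset$: { $T':=\emptyset$; for each $x\in T$: { $N:=\mathrm{pre}(x)\cap V$; $V:=V\setminus N$; $T':=T'\cup(N\setminus Q)$ }; $T:=T'$ }; return $V$. Here $\mathrm{pre}(x)=\{y\in X\mid(y,x)\in R\}$. -}

module Defs where

open import Data.Bool using (Bool; true; false; _∧_; _∨_; if_then_else_)
open import Data.Nat using (ℕ; zero; suc)
open import Data.Fin using (Fin)
open import Data.Fin.Subset using (Subset; _∈_; _∩_; _∪_; _─_)
open import Data.Fin.Subset.Properties using (nonempty?)
open import Data.List using (List; foldl; foldr; allFin)
open import Data.Vec using (tabulate; lookup)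
open import Data.Product using (Σ; _×_; _,_)
open import Data.Sum using (_⊎_)
open import Data.Unit using () renaming (⊤ to Unit)
open import Relation.Nullary using (¬_; does)
open import Relation.Binary.PropositionalEquality using (_≡_)

-- A finite quasi-discrete closure model: carrier X = Fin n,
-- a relation R ⊆ X × X given by its (Boolean) characteristic function,
-- a set P of proposition letters and a valuation 𝒱 : P → 2^X.
record Model (P : Set) : Set where
  field
    n : ℕ
    R : Fin n → Fin n → Bool
    𝒱 : P → Subset n
open Model public

data Formula (P : Set) : Set where
  prop : P → Formula P
  tt   : Formula P
  ¬'_  : Formula P → Formula P
  _∧'_ : Formula P → Formula P → Formula P
  ◇_   : Formula P → Formula P
  _𝒰_  : Formula P → Formula P → Formula P

module _ {P : Set} (M : Model P) where
  private
    X = Fin (n M)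

  -- closure 𝒞_R(A) = A ∪ {x | ∃ a ∈ A. (a,x) ∈ R}, on finite subsets
  𝒞 : Subset (n M) → Subset (n M)
  𝒞 A = tabulate λ x → lookup A x ∨ foldr (λ a b → (lookup A a ∧ R M a x) ∨ b) false (allFin (n M))

  𝓑⁺ : Subset (n M) → Subset (n M)
  𝓑⁺ A = 𝒞 A ─ A

  pre : X → Subset (n M)
  pre x = tabulate λ y → R M y x

  _⊨_ : X → Formula P → Set
  x ⊨ prop p = x ∈ 𝒱 M p
  x ⊨ tt = Unit
  x ⊨ (¬' φ) = ¬ (x ⊨ φ)
  x ⊨ (φ ∧' ψ) = (x ⊨ φ) × (x ⊨ ψ)
  -- x ∈ 𝒞_R({y | y ⊨ φ}) , unfolded
  x ⊨ (◇ φ) = (x ⊨ φ) ⊎ Σ X (λ a → (a ⊨ φ) × (R M a x ≡ true))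
  x ⊨ (φ 𝒰 ψ) = Σ (Subset (n M)) λ A →
                   (x ∈ A)
                 × ((y : X) → y ∈ A → y ⊨ φ)
                 × ((z : X) → z ∈ 𝓑⁺ A → z ⊨ ψ)

  -- one pass of the inner "for each x ∈ T" loop, visiting the elements of T in
  -- increasing order; state = (V , T')
  innerStep : Subset (n M) → Subset (n M) → (Subset (n M) × Subset (n M))
            → X → (Subset (n M) × Subset (n M))
  innerStep T Q (V , T') x =
    if lookup T x
    then (let N = pre x ∩ V in (V ─ N , T' ∪ (N ─ Q)))
    else (V , T')

  -- the while loop, run with fuel; fuel (suc n) suffices since each
  -- iteration producing a nonempty T' strictly shrinks V
  untilLoop : ℕ → Subset (n M) → Subset (n M) → Subset (n M) → Subset (n M)
  untilLoop zero V Q T = V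
  untilLoop (suc k) V Q T with does (nonempty? T)
  ... | false = V
  ... | true with foldl (innerStep T Q) (V , Data.Fin.Subset.⊥) (allFin (n M))
  ...   | (V' , T') = untilLoop k V' Q T'

  check : Formula P → Subset (n M)
  check (prop p) = 𝒱 M p
  check tt = Data.Fin.Subset.⊤
  check (¬' φ) = Data.Fin.Subset.⊤ ─ check φ
  check (φ ∧' ψ) = check φ ∩ check ψ
  check (◇ φ) = 𝒞 (check φ)
  check (φ 𝒰 ψ) =
    let V = check φ
        Q = check ψ
    in untilLoop (suc (n M)) V Q (𝓑⁺ (V ∪ Q))

module Submission where

-- The until case carries the content. One pass of the inner for-loop maps
-- (V , T) to (V′ , T′), where V′ keeps the points of V having no R-successor in
-- the frontier T and T′ collects the other points of V outside Q. A generic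
-- loop-invariant principle, with ∣ V ∣ as decreasing measure, shows that the
-- while loop stops with an empty frontier in a state satisfying any invariant
-- preserved by passes. With a soundness invariant, the result A satisfies
-- A ⊆ V₀ and 𝓑⁺ A ⊆ Q; with a completeness invariant, every such A stays below V.

open import Defs
open import Data.Fin using (Fin)
open import Data.Fin.Subset using (_∈_)
open import Function.Bundles using (_⇔_)

open import Data.Bool using (Bool; true; false; _∧_; _∨_; not)
open import Data.Bool.Properties using (∧-identityʳ; ∧-zeroʳ; ∧-assoc; ∧-comm; ∨-identityʳ)
open import Data.Empty using (⊥-elim)
open import Data.Fin.Subset using (Subset; _∉_; _⊆_; _∩_; _∪_; _─_; ⊤; ⊥; Nonempty; Empty; ∣_∣)
open import Data.Fin.Subset.Properties using (_∈?_; nonempty?; ∣p∣≤n; p⊂q⇒∣p∣<∣q∣; x∈p∪q⁺; x∈p∪q⁻; x∈p∩q⁺; x∈p∩q⁻; ∈⊤)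
open import Data.List using (List; []; _∷_; foldl; foldr; allFin)
open import Data.List.Membership.Propositional using () renaming (_∈_ to _∈ˡ_)
open import Data.List.Membership.Propositional.Properties using (∈-allFin)
open import Data.List.Relation.Unary.Any using (here; there)
open import Data.Nat using (ℕ; zero; suc; _<_; s≤s; s≤s⁻¹)
open import Data.Nat.Properties using (<-≤-trans)
open import Data.Product as Product using (∃; Σ; _×_; _,_; proj₁; proj₂)
open import Data.Sum as Sum using (_⊎_; inj₁; inj₂; [_,_]′)
import Data.Unit as Unit
open import Data.Vec using (lookup)
open import Data.Vec.Properties using (lookup-zipWith; lookup-replicate; lookup∘tabulate; []=⇒lookup; lookup⇒[]=)
open import Function.Base using (id; _∘_)
open import Function.Bundles using (mk⇔; Equivalence)
open import Relation.Nullary using (¬_; yes; no; contradiction)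
open import Relation.Binary.PropositionalEquality using (_≡_; refl; sym; trans; cong; cong₂; module ≡-Reasoning)

∧-true⁻ : ∀ {a b} → a ∧ b ≡ true → a ≡ true × b ≡ true
∧-true⁻ {true} {true} _ = refl , refl

∨-true⁻ : ∀ {a b} → a ∨ b ≡ true → a ≡ true ⊎ b ≡ true
∨-true⁻ {true}          _ = inj₁ refl
∨-true⁻ {false} {true}  _ = inj₂ refl

not-true⁻ : ∀ {a} → not a ≡ true → a ≡ false
not-true⁻ {false} _ = refl

true≢false : ∀ {a} → a ≡ true → ¬ a ≡ false
true≢false refl ()

∧-not-∧ : ∀ v r → v ∧ not (v ∧ r) ≡ v ∧ not r
∧-not-∧ true  r = refl
∧-not-∧ false r = refl

∧-not-∨ : ∀ v h H → (v ∧ not h) ∧ not H ≡ v ∧ not (h ∨ H)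
∧-not-∨ false h     H = refl
∧-not-∨ true  true  H = refl
∧-not-∨ true  false H = refl

∨-absorb : ∀ t v h H q → (t ∨ (v ∧ h ∧ q)) ∨ ((v ∧ not h) ∧ H ∧ q) ≡ t ∨ (v ∧ (h ∨ H) ∧ q)
∨-absorb true  v     h     H q = refl
∨-absorb false false h     H q = refl
∨-absorb false true  true  H q = ∨-identityʳ q
∨-absorb false true  false H q = refl

∈⇒true : ∀ {m} {x : Fin m} {p : Subset m} → x ∈ p → lookup p x ≡ true
∈⇒true = []=⇒lookup

true⇒∈ : ∀ {m} {x : Fin m} {p : Subset m} → lookup p x ≡ true → x ∈ p
true⇒∈ {x = x} {p} = lookup⇒[]= x p

false⇒∉ : ∀ {m} {x : Fin m} {p : Subset m} → lookup p x ≡ false → x ∉ p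
false⇒∉ eq x∈p = true≢false (∈⇒true x∈p) eq

∉⇒false : ∀ {m} {x : Fin m} {p : Subset m} → x ∉ p → lookup p x ≡ false
∉⇒false {x = x} {p} x∉p with lookup p x in eq
... | false = refl
... | true  = contradiction (true⇒∈ eq) x∉p

lookup-∩ : ∀ {m} (p q : Subset m) x → lookup (p ∩ q) x ≡ lookup p x ∧ lookup q x
lookup-∩ p q x = lookup-zipWith _∧_ x p q

lookup-∪ : ∀ {m} (p q : Subset m) x → lookup (p ∪ q) x ≡ lookup p x ∨ lookup q x
lookup-∪ p q x = lookup-zipWith _∨_ x p q

lookup-─ : ∀ {m} (p q : Subset m) x → lookup (p ─ q) x ≡ lookup p x ∧ not (lookup q x)
lookup-─ p q x with lookup p x | lookup q x | lookup-zipWith _ x p q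
... | a | true  | eq = trans eq (sym (∧-zeroʳ a))
... | a | false | eq = trans eq (sym (∧-identityʳ a))

∈─⁻ : ∀ {m} {x : Fin m} (p q : Subset m) → x ∈ p ─ q → x ∈ p × x ∉ q
∈─⁻ {x = x} p q x∈ with ∧-true⁻ (trans (sym (lookup-─ p q x)) (∈⇒true x∈))
... | x∈p , x∉q = true⇒∈ x∈p , false⇒∉ (not-true⁻ x∉q)

∈─⁺ : ∀ {m} {x : Fin m} (p q : Subset m) → x ∈ p → x ∉ q → x ∈ p ─ q
∈─⁺ {x = x} p q x∈p x∉q =
  true⇒∈ (trans (lookup-─ p q x) (cong₂ (λ a b → a ∧ not b) (∈⇒true x∈p) (∉⇒false x∉q)))

anyList : ∀ {A : Set} → (A → Bool) → List A → Bool
anyList f = foldr (λ a b → f a ∨ b) false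

anyList⁻ : ∀ {A : Set} (f : A → Bool) xs → anyList f xs ≡ true → ∃ λ a → f a ≡ true
anyList⁻ f (x ∷ xs) eq with ∨-true⁻ {f x} eq
... | inj₁ fx   = x , fx
... | inj₂ rest = anyList⁻ f xs rest

anyList⁺ : ∀ {A : Set} (f : A → Bool) {xs a} → a ∈ˡ xs → f a ≡ true → anyList f xs ≡ true
anyList⁺ f (here refl) fa rewrite fa = refl
anyList⁺ f {x ∷ _} (there a∈) fa with f x
... | true  = refl
... | false = anyList⁺ f a∈ fa

module _ {P : Set} (M : Model P) where

  private
    N : ℕ
    N = Model.n M

    X : Set
    X = Fin N

  ∈𝒞⁻ : ∀ {A x} → x ∈ 𝒞 M A → x ∈ A ⊎ ∃ λ a → a ∈ A × R M a x ≡ true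
  ∈𝒞⁻ {A} {x} x∈ with ∨-true⁻ (trans (sym (lookup∘tabulate _ x)) (∈⇒true x∈))
  ... | inj₁ x∈A = inj₁ (true⇒∈ x∈A)
  ... | inj₂ hit with anyList⁻ _ (allFin N) hit
  ...   | a , a∈A∧Rax with ∧-true⁻ a∈A∧Rax
  ...     | a∈A , Rax = inj₂ (a , true⇒∈ a∈A , Rax)

  ∈𝒞⁺ : ∀ {A x} → x ∈ A ⊎ ∃ (λ a → a ∈ A × R M a x ≡ true) → x ∈ 𝒞 M A
  ∈𝒞⁺ {A} {x} h = true⇒∈ (trans (lookup∘tabulate _ x) (disj h))
    where
    disj : x ∈ A ⊎ ∃ (λ a → a ∈ A × R M a x ≡ true) →
           lookup A x ∨ anyList (λ a → lookup A a ∧ R M a x) (allFin N) ≡ true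
    disj (inj₁ x∈A) rewrite ∈⇒true x∈A = refl
    disj (inj₂ (a , a∈A , Rax)) with lookup A x
    ... | true  = refl
    ... | false = anyList⁺ _ (∈-allFin a) (trans (cong (_∧ R M a x) (∈⇒true a∈A)) Rax)

  SuccessorsIn : Subset N → Subset N → Set
  SuccessorsIn A Q = ∀ {a z} → a ∈ A → R M a z ≡ true → z ∈ A ⊎ z ∈ Q

  boundary⊆⇒successorsIn : ∀ {A Q} → 𝓑⁺ M A ⊆ Q → SuccessorsIn A Q
  boundary⊆⇒successorsIn {A} B⊆Q {a} {z} a∈A Raz with z ∈? A
  ... | yes z∈A = inj₁ z∈A
  ... | no  z∉A = inj₂ (B⊆Q (∈─⁺ (𝒞 M A) A (∈𝒞⁺ (inj₂ (a , a∈A , Raz))) z∉A))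

  successorsIn⇒boundary⊆ : ∀ {A Q} → SuccessorsIn A Q → 𝓑⁺ M A ⊆ Q
  successorsIn⇒boundary⊆ {A} succ z∈B with ∈─⁻ (𝒞 M A) A z∈B
  ... | z∈𝒞A , z∉A with ∈𝒞⁻ z∈𝒞A
  ...   | inj₁ z∈A = contradiction z∈A z∉A
  ...   | inj₂ (a , a∈A , Raz) = [ (λ z∈A → contradiction z∈A z∉A) , id ]′ (succ a∈A Raz)

  module Iteration (Q : Subset N) where

    hasSuccIn : Subset N → X → Bool
    hasSuccIn T y = anyList (λ x → lookup T x ∧ R M y x) (allFin N)

    hasSuccIn⁺ : ∀ {T x y} → x ∈ T → R M y x ≡ true → hasSuccIn T y ≡ true
    hasSuccIn⁺ {x = x} x∈T Ryx =
      anyList⁺ _ (∈-allFin x) (cong₂ _∧_ (∈⇒true x∈T) Ryx)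

    hasSuccIn⁻ : ∀ {T y} → hasSuccIn T y ≡ true → ∃ λ x → x ∈ T × R M y x ≡ true
    hasSuccIn⁻ {T} {y} eq with anyList⁻ _ (allFin N) eq
    ... | x , hit = x , Product.map true⇒∈ id (∧-true⁻ hit)

    step : Subset N → Subset N → Subset N × Subset N
    step V T = foldl (innerStep M T Q) (V , ⊥) (allFin N)

    lookup-pre∩ : ∀ x V y → lookup (pre M x ∩ V) y ≡ lookup V y ∧ R M y x
    lookup-pre∩ x V y = begin
      lookup (pre M x ∩ V) y           ≡⟨ lookup-∩ (pre M x) V y ⟩
      lookup (pre M x) y ∧ lookup V y  ≡⟨ cong (_∧ lookup V y) (lookup∘tabulate _ y) ⟩
      R M y x ∧ lookup V y             ≡⟨ ∧-comm (R M y x) (lookup V y) ⟩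
      lookup V y ∧ R M y x             ∎
      where open ≡-Reasoning

    innerStep-V : ∀ T V T′ x y →
      lookup (proj₁ (innerStep M T Q (V , T′) x)) y ≡ lookup V y ∧ not (lookup T x ∧ R M y x)
    innerStep-V T V T′ x y with lookup T x
    ... | false = sym (∧-identityʳ (lookup V y))
    ... | true  = begin
      lookup (V ─ (pre M x ∩ V)) y                  ≡⟨ lookup-─ V (pre M x ∩ V) y ⟩
      lookup V y ∧ not (lookup (pre M x ∩ V) y)     ≡⟨ cong (λ b → lookup V y ∧ not b) (lookup-pre∩ x V y) ⟩
      lookup V y ∧ not (lookup V y ∧ R M y x)       ≡⟨ ∧-not-∧ (lookup V y) (R M y x) ⟩
      lookup V y ∧ not (R M y x)                    ∎
      where open ≡-Reasoning

    innerStep-T : ∀ T V T′ x y →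
      lookup (proj₂ (innerStep M T Q (V , T′) x)) y
        ≡ lookup T′ y ∨ (lookup V y ∧ (lookup T x ∧ R M y x) ∧ not (lookup Q y))
    innerStep-T T V T′ x y with lookup T x
    ... | false = sym (trans (cong (lookup T′ y ∨_) (∧-zeroʳ (lookup V y))) (∨-identityʳ (lookup T′ y)))
    ... | true  = begin
      lookup (T′ ∪ ((pre M x ∩ V) ─ Q)) y                            ≡⟨ lookup-∪ T′ _ y ⟩
      lookup T′ y ∨ lookup ((pre M x ∩ V) ─ Q) y                     ≡⟨ cong (lookup T′ y ∨_) (lookup-─ (pre M x ∩ V) Q y) ⟩
      lookup T′ y ∨ (lookup (pre M x ∩ V) y ∧ not (lookup Q y))      ≡⟨ cong (λ b → lookup T′ y ∨ (b ∧ not (lookup Q y))) (lookup-pre∩ x V y) ⟩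
      lookup T′ y ∨ ((lookup V y ∧ R M y x) ∧ not (lookup Q y))      ≡⟨ cong (lookup T′ y ∨_) (∧-assoc (lookup V y) _ _) ⟩
      lookup T′ y ∨ (lookup V y ∧ R M y x ∧ not (lookup Q y))        ∎
      where open ≡-Reasoning

    foldl-V : ∀ T xs s y →
      lookup (proj₁ (foldl (innerStep M T Q) s xs)) y
        ≡ lookup (proj₁ s) y ∧ not (anyList (λ x → lookup T x ∧ R M y x) xs)
    foldl-V T []       s y = sym (∧-identityʳ _)
    foldl-V T (x ∷ xs) s y = begin
      lookup (proj₁ (foldl (innerStep M T Q) (innerStep M T Q s x) xs)) y  ≡⟨ foldl-V T xs _ y ⟩
      lookup (proj₁ (innerStep M T Q s x)) y ∧ not H                       ≡⟨ cong (_∧ not H) (innerStep-V T _ _ x y) ⟩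
      (lookup (proj₁ s) y ∧ not h) ∧ not H                                 ≡⟨ ∧-not-∨ _ h H ⟩
      lookup (proj₁ s) y ∧ not (h ∨ H)                                     ∎
      where
      open ≡-Reasoning
      h H : Bool
      h = lookup T x ∧ R M y x
      H = anyList (λ x → lookup T x ∧ R M y x) xs

    foldl-T : ∀ T xs s y →
      lookup (proj₂ (foldl (innerStep M T Q) s xs)) y
        ≡ lookup (proj₂ s) y ∨ (lookup (proj₁ s) y ∧ anyList (λ x → lookup T x ∧ R M y x) xs ∧ not (lookup Q y))
    foldl-T T []       s y = sym (trans (cong (lookup (proj₂ s) y ∨_) (∧-zeroʳ _)) (∨-identityʳ _))
    foldl-T T (x ∷ xs) s y = begin
      lookup (proj₂ (foldl (innerStep M T Q) (innerStep M T Q s x) xs)) y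
        ≡⟨ foldl-T T xs _ y ⟩
      lookup (proj₂ (innerStep M T Q s x)) y ∨ (lookup (proj₁ (innerStep M T Q s x)) y ∧ H ∧ q)
        ≡⟨ cong₂ (λ a b → a ∨ (b ∧ H ∧ q)) (innerStep-T T _ _ x y) (innerStep-V T _ _ x y) ⟩
      (lookup (proj₂ s) y ∨ (lookup (proj₁ s) y ∧ h ∧ q)) ∨ ((lookup (proj₁ s) y ∧ not h) ∧ H ∧ q)
        ≡⟨ ∨-absorb (lookup (proj₂ s) y) (lookup (proj₁ s) y) h H q ⟩
      lookup (proj₂ s) y ∨ (lookup (proj₁ s) y ∧ (h ∨ H) ∧ q)
        ∎
      where
      open ≡-Reasoning
      h H q : Bool
      h = lookup T x ∧ R M y x
      H = anyList (λ x → lookup T x ∧ R M y x) xs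
      q = not (lookup Q y)

    step-V : ∀ V T y → lookup (proj₁ (step V T)) y ≡ lookup V y ∧ not (hasSuccIn T y)
    step-V V T = foldl-V T (allFin N) (V , ⊥)

    step-T : ∀ V T y →
      lookup (proj₂ (step V T)) y ≡ lookup V y ∧ hasSuccIn T y ∧ not (lookup Q y)
    step-T V T y = trans (foldl-T T (allFin N) (V , ⊥) y)
      (cong (_∨ (lookup V y ∧ hasSuccIn T y ∧ not (lookup Q y))) (lookup-replicate y false))

    NoSuccIn : Subset N → X → Set
    NoSuccIn T y = ∀ {x} → x ∈ T → ¬ R M y x ≡ true

    module Pass (V T : Subset N) where

      V′ T′ : Subset N
      V′ = proj₁ (step V T)
      T′ = proj₂ (step V T)

      V′⁻ : ∀ {y} → y ∈ V′ → y ∈ V × hasSuccIn T y ≡ false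
      V′⁻ {y} y∈ = Product.map true⇒∈ not-true⁻ (∧-true⁻ (trans (sym (step-V V T y)) (∈⇒true y∈)))

      V′⁺ : ∀ {y} → y ∈ V → hasSuccIn T y ≡ false → y ∈ V′
      V′⁺ {y} y∈V noSucc = true⇒∈ (trans (step-V V T y) (cong₂ (λ a b → a ∧ not b) (∈⇒true y∈V) noSucc))

      T′⁻ : ∀ {y} → y ∈ T′ → y ∈ V × hasSuccIn T y ≡ true × y ∉ Q
      T′⁻ {y} y∈ with ∧-true⁻ {lookup V y} (trans (sym (step-T V T y)) (∈⇒true y∈))
      ... | y∈V , rest = true⇒∈ y∈V , Product.map id (false⇒∉ ∘ not-true⁻) (∧-true⁻ rest)

      T′⁺ : ∀ {y} → y ∈ V → hasSuccIn T y ≡ true → y ∉ Q → y ∈ T′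
      T′⁺ {y} y∈V succ y∉Q = true⇒∈ (begin
        lookup T′ y                                      ≡⟨ step-T V T y ⟩
        lookup V y ∧ hasSuccIn T y ∧ not (lookup Q y)    ≡⟨ cong₂ (λ a b → a ∧ b ∧ not (lookup Q y)) (∈⇒true y∈V) succ ⟩
        not (lookup Q y)                                 ≡⟨ cong not (∉⇒false y∉Q) ⟩
        true                                             ∎)
        where open ≡-Reasoning

      V′⊆V : V′ ⊆ V
      V′⊆V = proj₁ ∘ V′⁻

      V′-noSucc : ∀ {y} → y ∈ V′ → NoSuccIn T y
      V′-noSucc y∈ x∈T Ryx = true≢false (hasSuccIn⁺ x∈T Ryx) (proj₂ (V′⁻ y∈))

      V′-keep : ∀ {y} → y ∈ V → NoSuccIn T y → y ∈ V′
      V′-keep {y} y∈V noSucc with hasSuccIn T y in eq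
      ... | false = V′⁺ y∈V eq
      ... | true with hasSuccIn⁻ {T} eq
      ...   | _ , x∈T , Ryx = ⊥-elim (noSucc x∈T Ryx)

      partition : ∀ {y} → y ∈ V → y ∈ V′ ⊎ y ∈ Q ⊎ y ∈ T′
      partition {y} y∈V with hasSuccIn T y in eq | y ∈? Q
      ... | false | _       = inj₁ (V′⁺ y∈V eq)
      ... | true  | yes y∈Q = inj₂ (inj₁ y∈Q)
      ... | true  | no  y∉Q = inj₂ (inj₂ (T′⁺ y∈V eq y∉Q))

      T′-removed : ∀ {y} → y ∈ T′ → y ∉ V′
      T′-removed y∈T′ y∈V′ = true≢false (proj₁ (proj₂ (T′⁻ y∈T′))) (proj₂ (V′⁻ y∈V′))

      T′⊆V : T′ ⊆ V
      T′⊆V = proj₁ ∘ T′⁻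

      T′-∉Q : ∀ {y} → y ∈ T′ → y ∉ Q
      T′-∉Q = proj₂ ∘ proj₂ ∘ T′⁻

      -- A pass on a nonempty frontier consumes one unit of fuel: either the
      -- new frontier is empty, or V′ ⊂ V because T′ ⊆ V ─ V′ is nonempty.
      fuel : ∀ {k} → Nonempty T → ∣ V ∣ < suc k ⊎ Empty T → ∣ V′ ∣ < k ⊎ Empty T′
      fuel ne (inj₂ empty) = contradiction ne empty
      fuel ne (inj₁ |V|<1+k) with nonempty? T′
      ... | no  empty      = inj₂ empty
      ... | yes (y , y∈T′) =
        inj₁ (<-≤-trans (p⊂q⇒∣p∣<∣q∣ (V′⊆V , y , T′⊆V y∈T′ , T′-removed y∈T′)) (s≤s⁻¹ |V|<1+k))

    loop : (Inv : Subset N → Subset N → Set) →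
           (∀ {V T} → Inv V T → Inv (Pass.V′ V T) (Pass.T′ V T)) →
           ∀ k {V T} → Inv V T → ∣ V ∣ < k ⊎ Empty T →
           ∃ λ T* → Inv (untilLoop M k V Q T) T* × Empty T*
    loop Inv pres zero    inv (inj₂ empty) = _ , inv , empty
    loop Inv pres (suc k) {V} {T} inv bound with nonempty? T
    ... | no  empty = T , inv , empty
    ... | yes ne with step V T | pres {V} {T} inv | Pass.fuel V T ne bound
    ...   | V′ , T′ | inv′ | bound′ = loop Inv pres k inv′ bound′

  -- The until loop computes the largest A ⊆ V₀ whose boundary lies in Q.
  module Until (V₀ Q : Subset N) where
    open Iteration Q

    T₀ result : Subset N
    T₀     = 𝓑⁺ M (V₀ ∪ Q)
    result = untilLoop M (suc N) V₀ Q T₀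

    initial-bound : ∣ V₀ ∣ < suc N ⊎ Empty T₀
    initial-bound = inj₁ (s≤s (∣p∣≤n V₀))

    Sound : Subset N → Subset N → Set
    Sound V T = V ⊆ V₀ × (∀ {a z} → a ∈ V → R M a z ≡ true → z ∈ V ⊎ z ∈ Q ⊎ z ∈ T)

    sound-initial : Sound V₀ T₀
    sound-initial = id , succ
      where
      succ : ∀ {a z} → a ∈ V₀ → R M a z ≡ true → z ∈ V₀ ⊎ z ∈ Q ⊎ z ∈ T₀
      succ {a} {z} a∈V₀ Raz with z ∈? V₀ ∪ Q
      ... | yes z∈V₀∪Q = Sum.map₂ inj₁ (x∈p∪q⁻ V₀ Q z∈V₀∪Q)
      ... | no  z∉V₀∪Q = inj₂ (inj₂ (∈─⁺ _ _ (∈𝒞⁺ (inj₂ (a , x∈p∪q⁺ (inj₁ a∈V₀) , Raz))) z∉V₀∪Q))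

    sound-pass : ∀ {V T} → Sound V T → Sound (Pass.V′ V T) (Pass.T′ V T)
    sound-pass {V} {T} (V⊆V₀ , succ) = V⊆V₀ ∘ V′⊆V , succ′
      where
      open Pass V T
      succ′ : ∀ {a z} → a ∈ V′ → R M a z ≡ true → z ∈ V′ ⊎ z ∈ Q ⊎ z ∈ T′
      succ′ a∈V′ Raz with succ (V′⊆V a∈V′) Raz
      ... | inj₁ z∈V          = partition z∈V
      ... | inj₂ (inj₁ z∈Q)   = inj₂ (inj₁ z∈Q)
      ... | inj₂ (inj₂ z∈T)   = ⊥-elim (V′-noSucc a∈V′ z∈T Raz)

    until-sound : ∀ {x} → x ∈ result → ∃ λ A → x ∈ A × A ⊆ V₀ × 𝓑⁺ M A ⊆ Q
    until-sound x∈ with loop Sound sound-pass (suc N) sound-initial initial-bound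
    ... | _ , (result⊆V₀ , succ) , empty =
      result , x∈ , result⊆V₀ , successorsIn⇒boundary⊆ λ a∈ Raz →
        Sum.map₂ [ id , (λ z∈T → contradiction (_ , z∈T) empty) ]′ (succ a∈ Raz)

    Complete : Subset N → Subset N → Subset N → Set
    Complete A V T = A ⊆ V × (∀ {t} → t ∈ T → t ∉ A × t ∉ Q)

    complete-initial : ∀ {A} → A ⊆ V₀ → Complete A V₀ T₀
    complete-initial A⊆V₀ = A⊆V₀ , λ t∈T₀ → let t∉V₀∪Q = proj₂ (∈─⁻ _ _ t∈T₀) in
      (λ t∈A → t∉V₀∪Q (x∈p∪q⁺ (inj₁ (A⊆V₀ t∈A)))) , (λ t∈Q → t∉V₀∪Q (x∈p∪q⁺ (inj₂ t∈Q)))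

    complete-pass : ∀ {A V T} → 𝓑⁺ M A ⊆ Q → Complete A V T → Complete A (Pass.V′ V T) (Pass.T′ V T)
    complete-pass {A} {V} {T} B⊆Q (A⊆V , avoid) = A⊆V′ , λ t∈T′ → (T′-removed t∈T′ ∘ A⊆V′) , T′-∉Q t∈T′
      where
      open Pass V T
      -- a successor of y ∈ A lies in A or Q, hence not in the frontier
      A⊆V′ : A ⊆ V′
      A⊆V′ y∈A = V′-keep (A⊆V y∈A) λ x∈T Ryx →
        [ proj₁ (avoid x∈T) , proj₂ (avoid x∈T) ]′ (boundary⊆⇒successorsIn B⊆Q y∈A Ryx)

    until-complete : ∀ {A x} → x ∈ A → A ⊆ V₀ → 𝓑⁺ M A ⊆ Q → x ∈ result
    until-complete {A} x∈A A⊆V₀ B⊆Q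
      with loop (Complete A) (complete-pass B⊆Q) (suc N) (complete-initial A⊆V₀) initial-bound
    ... | _ , (A⊆result , _) , _ = A⊆result x∈A

  _represents_ : Subset N → (X → Set) → Set
  S represents Pr = ∀ x → x ∈ S ⇔ Pr x

  complement-represents : ∀ {S Pr} → S represents Pr → (⊤ ─ S) represents (λ x → ¬ Pr x)
  complement-represents {S} rep x = mk⇔
    (λ x∈ pr → proj₂ (∈─⁻ ⊤ S x∈) (Equivalence.from (rep x) pr))
    (λ ¬pr → ∈─⁺ ⊤ S ∈⊤ (¬pr ∘ Equivalence.to (rep x)))

  intersection-represents : ∀ {S S′ Pr Pr′} → S represents Pr → S′ represents Pr′ →
                            (S ∩ S′) represents (λ x → Pr x × Pr′ x)
  intersection-represents {S} {S′} rep rep′ x = mk⇔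
    (Product.map (Equivalence.to (rep x)) (Equivalence.to (rep′ x)) ∘ x∈p∩q⁻ S S′)
    (x∈p∩q⁺ ∘ Product.map (Equivalence.from (rep x)) (Equivalence.from (rep′ x)))

  closure-represents : ∀ {S Pr} → S represents Pr →
                       𝒞 M S represents (λ x → Pr x ⊎ Σ X (λ a → Pr a × R M a x ≡ true))
  closure-represents rep x = mk⇔
    (Sum.map (Equivalence.to (rep x)) (Product.map₂ (Product.map (Equivalence.to (rep _)) id)) ∘ ∈𝒞⁻)
    (∈𝒞⁺ ∘ Sum.map (Equivalence.from (rep x)) (Product.map₂ (Product.map (Equivalence.from (rep _)) id)))

  until-represents : ∀ {V₀ Q Pr Pr′} → V₀ represents Pr → Q represents Pr′ →
    Until.result V₀ Q represents λ x → Σ (Subset N) λ A →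
      x ∈ A × (∀ y → y ∈ A → Pr y) × (∀ z → z ∈ 𝓑⁺ M A → Pr′ z)
  until-represents {V₀} {Q} rep rep′ x = mk⇔
    (λ x∈ → let (A , x∈A , A⊆V₀ , B⊆Q) = until-sound x∈ in
      A , x∈A , (λ y → Equivalence.to (rep y) ∘ A⊆V₀) , (λ z → Equivalence.to (rep′ z) ∘ B⊆Q))
    (λ (A , x∈A , A⊨ , B⊨) →
      until-complete x∈A (λ {y} → Equivalence.from (rep y) ∘ A⊨ y) (λ {z} → Equivalence.from (rep′ z) ∘ B⊨ z))
    where open Until V₀ Q

  check-represents : ∀ φ → check M φ represents (λ x → _⊨_ M x φ)
  check-represents (prop p) x = mk⇔ id id
  check-represents tt       x = mk⇔ (λ _ → Unit.tt) (λ _ → ∈⊤)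
  check-represents (¬' φ)     = complement-represents (check-represents φ)
  check-represents (φ ∧' ψ)   = intersection-represents (check-represents φ) (check-represents ψ)
  check-represents (◇ φ)      = closure-represents (check-represents φ)
  check-represents (φ 𝒰 ψ)    = until-represents (check-represents φ) (check-represents ψ)

theorem4 : {P : Set} (M : Model P) (φ : Formula P) (x : Fin (Model.n M)) →
           (x ∈ check M φ) ⇔ _⊨_ M x φ
theorem4 M φ = check-represents M φ
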